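{- Let $\lambda$ be a wide partition of $n$ with $\ell(\lambda)$ parts, and let $a$ be a positive integer. Then for all sufficiently large integers $b$, the partition $$\mu=(\underbrace{b,b,\ldots,b}_{a\text{ times}},\lambda_1,\lambda_2,\ldots,\lambda_{\ell(\lambda)})$$ is wide.
   Context: For partitions $\alpha,\beta$ of the same integer, $\alpha\ge\beta$ (dominance) means $\sum_{k\le j}\alpha_k\ge\sum_{k\le j}\beta_k$ for all $j$; $\nu'$ is the conjugate of $\nu$. $\nu$ is a subpartition of $\lambda$ if the multiset of parts of $\nu$ is a submultiset of that of $\lambda$. $\lambda$ is wide if $\nu\ge\nu'$ for every subpartition $\nu$ of $\lambda$. -}

module Defs where

open import Data.Nat using (ℕ; zero; suc; _+_; _≤_; _<_; _≥_)
open import Data.Nat.Properties using (_≤?_)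
open import Data.List using (List; []; _∷_; _++_; length; filter; take; map; upTo; replicate; head)
open import Data.List.Relation.Unary.All using (All)
open import Data.Nat.ListAction using (sum)
open import Data.List.Relation.Unary.Linked using (Linked)
open import Data.List.Relation.Binary.Permutation.Propositional using (_↭_)
open import Data.Product using (Σ; _×_)

IsPartition : List ℕ → Set
IsPartition xs = All (λ x → 1 ≤ x) xs × Linked _≥_ xs

size : List ℕ → ℕ
size = sum

largest : List ℕ → ℕ
largest [] = 0
largest (x ∷ _) = x

countGE : ℕ → List ℕ → ℕ
countGE i xs = length (filter (λ x → i ≤? x) xs)

-- conjugate partition: ν'_i = #{k : ν_k ≥ i}, i = 1 .. ν_1
conj : List ℕ → List ℕ
conj ν = map (λ i → countGE (suc i) ν) (upTo (largest ν))

-- sum of the first j parts (missing parts count as 0)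
psum : ℕ → List ℕ → ℕ
psum j xs = sum (take j xs)

_⊵_ : List ℕ → List ℕ → Set
α ⊵ β = ∀ j → psum j β ≤ psum j α

-- ν is a subpartition of λ: ν is a partition whose multiset of parts is
-- a submultiset of that of λ
Subpartition : List ℕ → List ℕ → Set
Subpartition ν λ' = IsPartition ν × Σ (List ℕ) (λ ρ → (ν ++ ρ) ↭ λ')

Wide : List ℕ → Set
Wide λ' = ∀ ν → Subpartition ν λ' → ν ⊵ conj ν

{-# OPTIONS --safe #-}
-- Take b > λ₁ and b ≥ K² where K = a + ℓ(λ). A subpartition ν of μ = (bᵃ, λ) whose
-- largest part is not b has all its parts below b, so it is a subpartition of λ.
-- Otherwise ν₁ = b and ν has L ≤ K parts; every part of ν′ is at most L, so for
-- j ≤ L the first j parts of ν′ sum to at most L² ≤ ν₁, while for j ≥ L both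
-- partial sums are |ν| = |ν′|.
module Submission where

open import Defs
open import Data.Nat using (ℕ; _≤_; _≥_)
open import Data.List using (List; replicate; _++_)
open import Data.Nat.ListAction using (sum)
open import Data.Product using (Σ; _×_)
open import Relation.Binary.PropositionalEquality using (_≡_)

open import Data.Bool using (true; false)
open import Data.Empty using (⊥-elim)
open import Data.List using ([]; _∷_; [_]; length; map; upTo)
open import Data.List.Membership.Propositional using (_∈_; _∉_)
open import Data.List.Membership.Propositional.Properties using (∈-++⁻; ∈-∃++)
open import Data.List.Properties
  using (length-++; length-++-≤ˡ; length-replicate; length-filter; ++-assoc;
         map-cong; map-upTo; map-applyUpTo; take-all)
open import Data.List.Relation.Binary.Permutation.Propositional using (_↭_; ↭-sym)
open import Data.List.Relation.Binary.Permutation.Propositional.Properties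
  using (∈-resp-↭; ↭-length; drop-mid)
open import Data.List.Relation.Unary.All as All using (All; []; _∷_)
import Data.List.Relation.Unary.All.Properties as All
open import Data.List.Relation.Unary.Any using (here; there)
open import Data.List.Relation.Unary.Linked using (Linked; []; [-]; _∷_)
open import Data.List.Relation.Unary.Linked.Properties using (Linked⇒All)
open import Data.Nat using (zero; suc; _+_; _*_; _<_; _≤ᵇ_; z≤n; s≤s)
open import Data.Nat.Properties
open import Algebra.Properties.CommutativeSemigroup +-commutativeSemigroup using (interchange)
open import Data.Product using (_,_; proj₂; ∃-syntax)
open import Data.Sum using (inj₁; inj₂)
open import Function using (_∘_)
open import Relation.Binary.PropositionalEquality using (refl; sym; trans; cong; cong₂; subst; module ≡-Reasoning)
open import Relation.Nullary using (yes; no)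

private
  variable
    A : Set
    b m : ℕ
    ν λ' : List ℕ

all-≤-largest : Linked _≥_ ν → All (_≤ largest ν) ν
all-≤-largest {[]} _ = []
all-≤-largest {_ ∷ _} sorted = Linked⇒All (λ i≥j j≥k → ≤-trans j≥k i≥j) ≤-refl sorted

sum-map-+ : ∀ (f g : ℕ → ℕ) (is : List ℕ) →
            sum (map (λ i → f i + g i) is) ≡ sum (map f is) + sum (map g is)
sum-map-+ f g [] = refl
sum-map-+ f g (i ∷ is) =
  trans (cong (f i + g i +_) (sum-map-+ f g is)) (interchange (f i) (g i) _ _)

sum-map-zero : ∀ (is : List ℕ) → sum (map (λ _ → 0) is) ≡ 0
sum-map-zero [] = refl
sum-map-zero (_ ∷ is) = sum-map-zero is

sum-map-upTo-suc : ∀ (f : ℕ → ℕ) m →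
                   sum (map f (upTo (suc m))) ≡ f 0 + sum (map (f ∘ suc) (upTo m))
sum-map-upTo-suc f m =
  cong (λ xs → f 0 + sum xs) (trans (map-applyUpTo suc f m) (sym (map-upTo (f ∘ suc) m)))

countGE-∷ : ∀ i x xs → countGE i (x ∷ xs) ≡ countGE i [ x ] + countGE i xs
countGE-∷ i x xs with i ≤ᵇ x
... | true = refl
... | false = refl

countGE-suc-[_] : ∀ x i → countGE (suc (suc i)) [ suc x ] ≡ countGE (suc i) [ x ]
countGE-suc-[ x ] i with suc i ≤ᵇ x
... | true = refl
... | false = refl

sum-countGE-[_] : ∀ x {m} → x ≤ m → sum (map (λ i → countGE (suc i) [ x ]) (upTo m)) ≡ x
sum-countGE-[ zero ] {m} _ = sum-map-zero (upTo m)
sum-countGE-[ suc x ] {suc m} (s≤s x≤m) = begin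
  sum (map (λ i → countGE (suc i) [ suc x ]) (upTo (suc m)))
    ≡⟨ sum-map-upTo-suc (λ i → countGE (suc i) [ suc x ]) m ⟩
  suc (sum (map (λ i → countGE (suc (suc i)) [ suc x ]) (upTo m)))
    ≡⟨ cong (suc ∘ sum) (map-cong countGE-suc-[ x ] (upTo m)) ⟩
  suc (sum (map (λ i → countGE (suc i) [ x ]) (upTo m)))
    ≡⟨ cong suc (sum-countGE-[ x ] x≤m) ⟩
  suc x ∎
  where open ≡-Reasoning

sum-countGE : All (_≤ m) ν → sum (map (λ i → countGE (suc i) ν) (upTo m)) ≡ sum ν
sum-countGE {m} [] = sum-map-zero (upTo m)
sum-countGE {m} {x ∷ ν} (x≤m ∷ ν≤m) = begin
  sum (map (λ i → countGE (suc i) (x ∷ ν)) (upTo m))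
    ≡⟨ cong sum (map-cong (λ i → countGE-∷ (suc i) x ν) (upTo m)) ⟩
  sum (map (λ i → countGE (suc i) [ x ] + countGE (suc i) ν) (upTo m))
    ≡⟨ sum-map-+ _ _ (upTo m) ⟩
  sum (map (λ i → countGE (suc i) [ x ]) (upTo m)) + sum (map (λ i → countGE (suc i) ν) (upTo m))
    ≡⟨ cong₂ _+_ (sum-countGE-[ x ] x≤m) (sum-countGE ν≤m) ⟩
  x + sum ν ∎
  where open ≡-Reasoning

sum-conj : Linked _≥_ ν → sum (conj ν) ≡ sum ν
sum-conj sorted = sum-countGE (all-≤-largest sorted)

psum≤sum : ∀ j xs → psum j xs ≤ sum xs
psum≤sum zero xs = z≤n
psum≤sum (suc j) [] = z≤n
psum≤sum (suc j) (x ∷ xs) = +-monoʳ-≤ x (psum≤sum j xs)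

psum≤* : ∀ {L} j {xs} → All (_≤ L) xs → psum j xs ≤ j * L
psum≤* zero _ = z≤n
psum≤* (suc j) [] = z≤n
psum≤* (suc j) (x≤L ∷ xs≤L) = +-mono-≤ x≤L (psum≤* j xs≤L)

largest≤psum : ∀ j ν → largest ν ≤ psum (suc j) ν
largest≤psum j [] = z≤n
largest≤psum j (x ∷ ν) = m≤m+n x (psum j ν)

conj-≤-length : ∀ ν → All (_≤ length ν) (conj ν)
conj-≤-length ν = All.map⁺ (All.universal (λ i → length-filter (suc i ≤?_) ν) _)

⊵-conj-of-long-first-row : Linked _≥_ ν → length ν * length ν ≤ largest ν → ν ⊵ conj ν
⊵-conj-of-long-first-row _ _ zero = z≤n
⊵-conj-of-long-first-row {ν} sorted long (suc j) with suc j ≤? length ν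
... | yes j<L = begin
  psum (suc j) (conj ν)  ≤⟨ psum≤* (suc j) (conj-≤-length ν) ⟩
  suc j * length ν       ≤⟨ *-monoˡ-≤ (length ν) j<L ⟩
  length ν * length ν    ≤⟨ long ⟩
  largest ν              ≤⟨ largest≤psum j ν ⟩
  psum (suc j) ν         ∎
  where open ≤-Reasoning
... | no j≮L = begin
  psum (suc j) (conj ν)  ≤⟨ psum≤sum (suc j) (conj ν) ⟩
  sum (conj ν)           ≡⟨ sum-conj sorted ⟩
  sum ν                  ≡⟨ cong sum (take-all (suc j) ν (≰⇒≥ j≮L)) ⟨
  psum (suc j) ν         ∎
  where open ≤-Reasoning

↭-cancel-disjoint : ∀ (xs : List A) {ys ν ρ} → All (_∉ xs) ν → ν ++ ρ ↭ xs ++ ys →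
                    ∃[ ρ′ ] ν ++ ρ′ ↭ ys
↭-cancel-disjoint [] _ ν⊆ys = _ , ν⊆ys
↭-cancel-disjoint (x ∷ xs) {ys} {ν} {ρ} disjoint ν⊆xys
  with ∈-++⁻ ν (∈-resp-↭ (↭-sym ν⊆xys) (here refl))
... | inj₁ x∈ν = ⊥-elim (All.lookup disjoint x∈ν (here refl))
... | inj₂ x∈ρ with ρ₁ , ρ₂ , refl ← ∈-∃++ x∈ρ =
  ↭-cancel-disjoint xs (All.map (_∘ there) disjoint)
    (subst (_↭ xs ++ ys) (++-assoc ν ρ₁ ρ₂)
      (drop-mid (ν ++ ρ₁) [] (subst (_↭ x ∷ xs ++ ys) (sym (++-assoc ν ρ₁ (x ∷ ρ₂))) ν⊆xys)))

replicate-++-sorted : ∀ a → largest λ' ≤ b → Linked _≥_ λ' → Linked _≥_ (replicate a b ++ λ')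
replicate-++-sorted zero _ sorted = sorted
replicate-++-sorted {[]} (suc zero) _ _ = [-]
replicate-++-sorted {_ ∷ _} (suc zero) λ≤b sorted = λ≤b ∷ sorted
replicate-++-sorted (suc (suc a)) λ≤b sorted = ≤-refl ∷ replicate-++-sorted (suc a) λ≤b sorted

replicate-++-isPartition : ∀ a → 1 ≤ b → largest λ' ≤ b → IsPartition λ' →
                           IsPartition (replicate a b ++ λ')
replicate-++-isPartition a b≥1 λ≤b (positive , sorted) =
  All.++⁺ (All.replicate⁺ a b≥1) positive , replicate-++-sorted a λ≤b sorted

replicate-++-wide : ∀ a → Linked _≥_ λ' → Wide λ' → largest λ' < b →
                    (a + length λ') * (a + length λ') ≤ b → Wide (replicate a b ++ λ')
replicate-++-wide a _ _ _ _ [] _ _ = ≤-refl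
replicate-++-wide {λ'} {b} a sorted wide λ<b long (x ∷ ν) (ν-partition , ρ , ν⊆μ) with x ≟ b
... | yes refl = ⊵-conj-of-long-first-row (proj₂ ν-partition) (≤-trans (*-mono-≤ L≤K L≤K) long)
  where
  open ≤-Reasoning
  L≤K : length (x ∷ ν) ≤ a + length λ'
  L≤K = begin
    length (x ∷ ν)                      ≤⟨ length-++-≤ˡ (x ∷ ν) ⟩
    length ((x ∷ ν) ++ ρ)               ≡⟨ ↭-length ν⊆μ ⟩
    length (replicate a b ++ λ')        ≡⟨ length-++ (replicate a b) ⟩
    length (replicate a b) + length λ'  ≡⟨ cong (_+ length λ') (length-replicate a) ⟩
    a + length λ'                       ∎
... | no x≢b = wide (x ∷ ν) (ν-partition , ↭-cancel-disjoint (replicate a b) parts∉ ν⊆μ)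
  where
  ∈-replicate⇒≡ : ∀ {y} → y ∈ replicate a b → y ≡ b
  ∈-replicate⇒≡ = All.lookup (All.replicate⁺ {P = _≡ b} a refl)
  x<b : x < b
  x<b with ∈-++⁻ (replicate a b) (∈-resp-↭ ν⊆μ (here refl))
  ... | inj₁ x∈bᵃ = ⊥-elim (x≢b (∈-replicate⇒≡ x∈bᵃ))
  ... | inj₂ x∈λ = ≤-<-trans (All.lookup (all-≤-largest sorted) x∈λ) λ<b
  parts∉ : All (_∉ replicate a b) (x ∷ ν)
  parts∉ = All.map (λ y≤x y∈bᵃ → <⇒≢ (≤-<-trans y≤x x<b) (∈-replicate⇒≡ y∈bᵃ))
                   (all-≤-largest (proj₂ ν-partition))

lemma2 : (n : ℕ) (λ' : List ℕ) → IsPartition λ' → sum λ' ≡ n → Wide λ' →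
         (a : ℕ) → 1 ≤ a →
         Σ ℕ (λ B → ∀ b → B ≤ b →
           IsPartition (replicate a b ++ λ') × Wide (replicate a b ++ λ'))
lemma2 _ λ' λ-partition _ wide a _ = suc (largest λ') + K * K , λ b B≤b →
  let λ<b = ≤-trans (m≤m+n _ (K * K)) B≤b
      K²≤b = ≤-trans (m≤n+m (K * K) _) B≤b
  in replicate-++-isPartition a (≤-trans (s≤s z≤n) λ<b) (<⇒≤ λ<b) λ-partition
   , replicate-++-wide a (proj₂ λ-partition) wide λ<b K²≤b
  where K = a + length λ'
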